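{- Let $P=(X,\leq_P)$ be a connected finite poset with at least two minimal points and at least two maximal points, and let $C$ be a 4-crown with $L(C)=\{a,b\}$ and $U(C)=\{v,w\}$. \begin{enumerate} \item There exists a surjective order homomorphism from $P$ onto $C$ if and only if there exists a separating homomorphism from $\mathfrak{F}(P)$ to $\mathfrak{C}$. \item If $C\subseteq E(P)$ (i.e. $C$ is a 4-crown of $P$ all of whose points are extremal points of $P$), then $C$ is a retract of $P$ if and only if there exists a $C$-separating homomorphism from $\mathfrak{F}(P)$ to $\mathfrak{C}$. \end{enumerate}
   Context: All posets are finite and nonempty; subsets of a poset are identified with the induced subposets. For a poset $P=(X,\leq_P)$: $L(P)$ and $U(P)$ are the sets of minimal and maximal points, $E(P)=L(P)\cup U(P)$, $M(P)=X\setminus E(P)$; ${\downarrow}_P y=\{x: x\leq_P y\}$, ${\uparrow}_P y=\{x: y\leq_P x\}$, $[x,y]_P={\uparrow}_P x\cap{\downarrow}_P y$. The comparability graph of $Y\subseteq X$ has vertex set $Y$ and an edge $\{x,y\}$ for each pair of distinct comparable elements; $Y$ is a crown if its comparability graph is a cycle; an $n$-crown is a crown with $n$ points. A 4-crown $D=\{a,b,v,w\}$ with $L(D)=\{a,b\}$, $U(D)=\{v,w\}$ has inner $\mathcal{I}_P(D)=[a,v]_P\cap[b,w]_P$; $D$ is improper if $\mathcal{I}_P(D)\neq\emptyset$ and proper otherwise. An (order) homomorphism is an order-preserving map; a retraction of $P$ is an idempotent homomorphism $r:P\to P$ and its image (as induced subposet) is a retract of $P$. For the fixed 4-crown $C$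 with $L(C)=\{a,b\}$, $U(C)=\{v,w\}$: $\mathcal{C}_{23}$ is the set of subsets of $C$ with 2 or 3 elements that are connected as induced subposets of $C$ (namely $\{a,v\},\{a,w\},\{b,v\},\{b,w\}$ and $abv,abw,avw,bvw$, where $xyz$ denotes $\{x,y,z\}$). $\mathfrak{C}$ is the undirected multigraph with vertex set $\mathcal{C}_{23}$ having, for $S,T\in\mathcal{C}_{23}$ (including $S=T$, giving loops), an L-edge between $S$ and $T$ iff $L(C)\cap S\cap T\neq\emptyset$ and a U-edge iff $U(C)\cap S\cap T\neq\emptyset$. Let $\mathcal{A}=\{S\in\mathcal{C}_{23}: L(C)\cap S=\{a\}\}$, $\mathcal{B}=\{S: L(C)\cap S=\{b\}\}$, $\mathcal{V}=\{S: U(C)\cap S=\{v\}\}$, $\mathcal{W}=\{S: U(C)\cap S=\{w\}\}$. $\mathcal{F}(P)$ is the set of improper 4-crowns of $P$ contained in $E(P)$, and $\mathfrak{F}(P)$ is the multigraph with vertex set $\mathcal{F}(P)$ having an L-edge between $F,G$ iff $L(P)\cap F\cap G\neq\emptyset$ and a U-edge iff $U(P)\cap F\cap G\neq\emptyset$. A homomorphism $\phi:\mathfrak{F}(P)\to\mathfrak{C}$ is a map $\mathcal{F}(P)\to\mathcal{C}_{23}$ such that L-edges (U-edges) between $F,G$ imply L-edges (U-edges) between $\phi(F),\phi(G)$. Such $\phi$ is separating if there exist $x\neq x'$ in $L(P)$ and $y\neq y'$ in $U(P)$ such that for all $F\in\mathcal{F}(P)$: $x\in F\Rightarrow\phi(F)\notin\mathcal{A}$;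 $x'\in F\Rightarrow\phi(F)\notin\mathcal{B}$; $y\in F\Rightarrow\phi(F)\notin\mathcal{V}$; $y'\in F\Rightarrow\phi(F)\notin\mathcal{W}$. It is $D$-separating, for a 4-crown $D\subseteq E(P)$, if it is separating with witnesses satisfying $\{x,x',y,y'\}=D$. -}

module Defs where

open import Data.Nat using (ℕ)
open import Data.Fin using (Fin)
open import Data.Fin.Subset using (Subset; _∈_)
open import Data.Product using (Σ; ∃; ∃-syntax; _×_; _,_)
open import Data.Sum using (_⊎_)
open import Relation.Nullary using (¬_)
open import Relation.Binary using (Decidable; IsPartialOrder)
open import Relation.Binary.PropositionalEquality using (_≡_; _≢_)
open import Function.Bundles using (_⇔_)

record FinPoset : Set₁ where
  field
    n              : ℕ
    _≤_            : Fin n → Fin n → Set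
    isPartialOrder : IsPartialOrder _≡_ _≤_
    _≤?_           : Decidable _≤_

data CPt : Set where
  ca cb cv cw : CPt

data _≤C_ : CPt → CPt → Set where
  ≤C-refl : ∀ {c} → c ≤C c
  a≤v : ca ≤C cv
  a≤w : ca ≤C cw
  b≤v : cb ≤C cv
  b≤w : cb ≤C cw

LC : CPt → Set
LC c = (c ≡ ca) ⊎ (c ≡ cb)

UC : CPt → Set
UC c = (c ≡ cv) ⊎ (c ≡ cw)

-- 𝒞₂₃: the connected 2- and 3-element subsets of C.
data C23 : Set where
  `av `aw `bv `bw `abv `abw `avw `bvw : C23

data _∈C_ : CPt → C23 → Set where
  a∈av : ca ∈C `av
  v∈av : cv ∈C `av
  a∈aw : ca ∈C `aw
  w∈aw : cw ∈C `aw
  b∈bv : cb ∈C `bv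
  v∈bv : cv ∈C `bv
  b∈bw : cb ∈C `bw
  w∈bw : cw ∈C `bw
  a∈abv : ca ∈C `abv
  b∈abv : cb ∈C `abv
  v∈abv : cv ∈C `abv
  a∈abw : ca ∈C `abw
  b∈abw : cb ∈C `abw
  w∈abw : cw ∈C `abw
  a∈avw : ca ∈C `avw
  v∈avw : cv ∈C `avw
  w∈avw : cw ∈C `avw
  b∈bvw : cb ∈C `bvw
  v∈bvw : cv ∈C `bvw
  w∈bvw : cw ∈C `bvw

-- edges of the multigraph 𝔆 (S = T allowed: loops)
LEdgeC : C23 → C23 → Set
LEdgeC S T = ∃[ c ] (LC c × c ∈C S × c ∈C T)

UEdgeC : C23 → C23 → Set
UEdgeC S T = ∃[ c ] (UC c × c ∈C S × c ∈C T)

𝒜 : C23 → Set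
𝒜 S = ∀ c → (LC c × c ∈C S) ⇔ (c ≡ ca)

ℬ : C23 → Set
ℬ S = ∀ c → (LC c × c ∈C S) ⇔ (c ≡ cb)

𝒱 : C23 → Set
𝒱 S = ∀ c → (UC c × c ∈C S) ⇔ (c ≡ cv)

𝒲 : C23 → Set
𝒲 S = ∀ c → (UC c × c ∈C S) ⇔ (c ≡ cw)

module _ (P : FinPoset) where
  open FinPoset P

  _<_ : Fin n → Fin n → Set
  x < y = (x ≤ y) × (x ≢ y)

  Comparable : Fin n → Fin n → Set
  Comparable x y = (x ≤ y) ⊎ (y ≤ x)

  Minimal : Fin n → Set
  Minimal x = ∀ y → y ≤ x → y ≡ x

  Maximal : Fin n → Set
  Maximal x = ∀ y → x ≤ y → y ≡ x

  Extremal : Fin n → Set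
  Extremal x = Minimal x ⊎ Maximal x

  data CompPath : Fin n → Fin n → Set where
    here : ∀ {x} → CompPath x x
    step : ∀ {x y z} → Comparable x y → CompPath y z → CompPath x z

  Connected : Set
  Connected = ∀ x y → CompPath x y

  Crown4 : Fin n → Fin n → Fin n → Fin n → Set
  Crown4 a b v w =
    (a < v) × (a < w) × (b < v) × (b < w) ×
    (¬ Comparable a b) × (¬ Comparable v w)

  IsSet4 : Subset n → Fin n → Fin n → Fin n → Fin n → Set
  IsSet4 S a b v w =
    ∀ z → (z ∈ S) ⇔ ((z ≡ a) ⊎ (z ≡ b) ⊎ (z ≡ v) ⊎ (z ≡ w))

  InnerNonempty : Fin n → Fin n → Fin n → Fin n → Set
  InnerNonempty a b v w =
    ∃[ z ] ((a ≤ z × z ≤ v) × (b ≤ z × z ≤ w))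

  ImproperCrown4 : Subset n → Set
  ImproperCrown4 S =
    ∃[ a ] ∃[ b ] ∃[ v ] ∃[ w ]
      (Crown4 a b v w × IsSet4 S a b v w × InnerNonempty a b v w)

  InF : Subset n → Set
  InF S = ImproperCrown4 S × (∀ z → z ∈ S → Extremal z)

  LEdgeP : Subset n → Subset n → Set
  LEdgeP F G = ∃[ x ] (Minimal x × x ∈ F × x ∈ G)

  UEdgeP : Subset n → Subset n → Set
  UEdgeP F G = ∃[ x ] (Maximal x × x ∈ F × x ∈ G)

  -- homomorphism 𝔉(P) → 𝔆 (represented as a total map on subsets;
  -- only its values on 𝓕(P) matter)
  IsHom : (Subset n → C23) → Set
  IsHom φ = ∀ F G → InF F → InF G →
    (LEdgeP F G → LEdgeC (φ F) (φ G)) × (UEdgeP F G → UEdgeC (φ F) (φ G))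

  SeparatingWith : (Subset n → C23) → Fin n → Fin n → Fin n → Fin n → Set
  SeparatingWith φ x x′ y y′ =
    Minimal x × Minimal x′ × (x ≢ x′) ×
    Maximal y × Maximal y′ × (y ≢ y′) ×
    (∀ F → InF F →
      (x ∈ F → ¬ 𝒜 (φ F)) × (x′ ∈ F → ¬ ℬ (φ F)) ×
      (y ∈ F → ¬ 𝒱 (φ F)) × (y′ ∈ F → ¬ 𝒲 (φ F)))

  Separating : (Subset n → C23) → Set
  Separating φ = ∃[ x ] ∃[ x′ ] ∃[ y ] ∃[ y′ ] SeparatingWith φ x x′ y y′

  DSeparating : (Subset n → C23) → Fin n → Fin n → Fin n → Fin n → Set
  DSeparating φ a b v w = ∃[ x ] ∃[ x′ ] ∃[ y ] ∃[ y′ ]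
    (SeparatingWith φ x x′ y y′ ×
     (∀ z → ((z ≡ x) ⊎ (z ≡ x′) ⊎ (z ≡ y) ⊎ (z ≡ y′))
          ⇔ ((z ≡ a) ⊎ (z ≡ b) ⊎ (z ≡ v) ⊎ (z ≡ w))))

  TwoMinimal : Set
  TwoMinimal = ∃[ x ] ∃[ x′ ] (Minimal x × Minimal x′ × x ≢ x′)

  TwoMaximal : Set
  TwoMaximal = ∃[ y ] ∃[ y′ ] (Maximal y × Maximal y′ × y ≢ y′)

  SurjHomOntoC : Set
  SurjHomOntoC = Σ (Fin n → CPt) λ f → ((∀ x y → x ≤ y → f x ≤C f y) × (∀ c → ∃[ x ] (f x ≡ c)))

  IsRetract4 : Fin n → Fin n → Fin n → Fin n → Set
  IsRetract4 a b v w = Σ (Fin n → Fin n) λ r →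
    ((∀ x y → x ≤ y → r x ≤ r y) ×
     (∀ x → r (r x) ≡ r x) ×
     (∀ z → (∃[ y ] (r y ≡ z)) ⇔ ((z ≡ a) ⊎ (z ≡ b) ⊎ (z ≡ v) ⊎ (z ≡ w))))

module Submission where

-- Sorting the minimal points of P by whether a homomorphism f : P → C sends them to b, and the
-- maximal points by whether f sends them to w, every improper crown F ⊆ E(P) meets at most three
-- of the four classes, because f maps its inner to a single point of C; so F can be sent to a
-- member of 𝒞₂₃ containing the classes it meets, and this is a separating homomorphism.
-- Conversely, a separating φ labels minimal points a or b and maximal points v or w, the L- and
-- U-edges of 𝔉(P) making the labels agree across crowns. The labelling extends monotonically
-- to P (points lying below maximal points of both labels go to a or b, the others to v or w):
-- any failure would exhibit an improper crown in E(P) whose image lies in none of 𝒜, ℬ, 𝒱, 𝒲.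
-- A retraction of P onto a crown D ⊆ E(P) is the same as a homomorphism onto C that is the
-- identity on D ≅ C, and the separating witnesses are exactly the points of D.

open import Data.Bool using (true; false; if_then_else_)
open import Data.Fin using (Fin; _≟_)
open import Data.Fin.Induction using (po-wellFounded)
open import Data.Fin.Properties using (any?; all?)
open import Data.Fin.Subset using (Subset; _∈_; ⁅_⁆; _∪_)
open import Data.Fin.Subset.Properties using (_∈?_; anySubset?; ∪⇔⊎; x∈⁅y⁆⇔x≡y)
open import Data.Product using (Σ; ∃-syntax; _×_; _,_; proj₁; proj₂)
open import Data.Sum using (_⊎_; inj₁; inj₂; [_,_]′)
open import Data.Sum.Function.Propositional using (_⊎-⇔_)
open import Data.Empty using (⊥; ⊥-elim)
open import Function using (_∘_; case_of_; flip)
open import Function.Bundles using (_⇔_; mk⇔; Equivalence)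
open import Function.Construct.Composition using (_⇔-∘_)
open import Induction.WellFounded using (Acc; acc)
open import Relation.Binary using (IsPartialOrder)
import Relation.Binary.Construct.Flip.EqAndOrd as Flip
open import Relation.Binary.PropositionalEquality using (_≡_; _≢_; refl; sym; trans; cong; subst; subst₂)
open import Relation.Nullary using (¬_; Dec; yes; no; does; ¬?)
open import Relation.Nullary.Decidable
  using (_×-dec_; _⊎-dec_; _→-dec_; map′; dec-true; dec-false; does-⇔; decidable-stable)

open import Defs

open Equivalence using (to; from)

section⇒injective : {A B : Set} {f : A → B} {h : B → A} →
  (∀ c → f (h c) ≡ c) → ∀ {c d} → h c ≡ h d → c ≡ d
section⇒injective {f = f} sec {c} {d} e = trans (sym (sec c)) (trans (cong f e) (sec d))

retraction-fixes-image : {A : Set} {r : A → A} →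
  (∀ x → r (r x) ≡ r x) → ∀ {u z} → r u ≡ z → r z ≡ z
retraction-fixes-image {r = r} idem {u} e = trans (cong r (sym e)) (trans (idem u) e)

_⇔-dec_ : {A B : Set} → Dec A → Dec B → Dec (A ⇔ B)
a? ⇔-dec b? = map′ (λ (f , g) → mk⇔ f g) (λ e → to e , from e) ((a? →-dec b?) ×-dec (b? →-dec a?))

OneOf : {A : Set} → A → A → A → A → A → Set
OneOf a b v w z = (z ≡ a) ⊎ (z ≡ b) ⊎ (z ≡ v) ⊎ (z ≡ w)

OneOf-swap : {A : Set} {a b v w z : A} → OneOf a b v w z → OneOf b a w v z
OneOf-swap (inj₁ e) = inj₂ (inj₁ e)
OneOf-swap (inj₂ (inj₁ e)) = inj₁ e
OneOf-swap (inj₂ (inj₂ (inj₁ e))) = inj₂ (inj₂ (inj₂ e))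
OneOf-swap (inj₂ (inj₂ (inj₂ e))) = inj₂ (inj₂ (inj₁ e))

corners : {A : Set} → A → A → A → A → CPt → A
corners a b v w ca = a
corners a b v w cb = b
corners a b v w cv = v
corners a b v w cw = w

corners-∈ : {A : Set} {a b v w : A} → ∀ c → OneOf a b v w (corners a b v w c)
corners-∈ ca = inj₁ refl
corners-∈ cb = inj₂ (inj₁ refl)
corners-∈ cv = inj₂ (inj₂ (inj₁ refl))
corners-∈ cw = inj₂ (inj₂ (inj₂ refl))

corners-onto : {A : Set} {a b v w z : A} → OneOf a b v w z → ∃[ c ] (corners a b v w c ≡ z)
corners-onto (inj₁ refl) = ca , refl
corners-onto (inj₂ (inj₁ refl)) = cb , refl
corners-onto (inj₂ (inj₂ (inj₁ refl))) = cv , refl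
corners-onto (inj₂ (inj₂ (inj₂ refl))) = cw , refl

ca≢cb : ca ≢ cb
ca≢cb ()

cv≢cw : cv ≢ cw
cv≢cw ()

≡cb? : ∀ c → Dec (c ≡ cb)
≡cb? ca = no (λ ())
≡cb? cb = yes refl
≡cb? cv = no (λ ())
≡cb? cw = no (λ ())

≡cw? : ∀ c → Dec (c ≡ cw)
≡cw? ca = no (λ ())
≡cw? cb = no (λ ())
≡cw? cv = no (λ ())
≡cw? cw = yes refl

≤C-antisym : ∀ {c d} → c ≤C d → d ≤C c → c ≡ d
≤C-antisym ≤C-refl _ = refl

≤C-minimal : ∀ {c d} → LC c → d ≤C c → d ≡ c
≤C-minimal (inj₁ refl) ≤C-refl = refl
≤C-minimal (inj₂ refl) ≤C-refl = refl

≤C-maximal : ∀ {c d} → UC c → c ≤C d → d ≡ c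
≤C-maximal (inj₁ refl) ≤C-refl = refl
≤C-maximal (inj₂ refl) ≤C-refl = refl

no-point-between-mixed-bounds : ∀ {c₀ c₁ d e₀ e₁} → c₀ ≤C d → c₁ ≤C d → d ≤C e₀ → d ≤C e₁ →
  c₀ ≢ cb → c₁ ≡ cb → e₀ ≢ cw → e₁ ≡ cw → ⊥
no-point-between-mixed-bounds ≤C-refl ≤C-refl _ _ c₀≢cb refl _ refl = c₀≢cb refl
no-point-between-mixed-bounds _ b≤w ≤C-refl _ _ refl e₀≢cw refl = e₀≢cw refl

𝒜-intro : ∀ {S} → ca ∈C S → ¬ cb ∈C S → 𝒜 S
𝒜-intro a∈S b∉S c = mk⇔ (λ { (inj₁ e , _) → e ; (inj₂ refl , b∈S) → ⊥-elim (b∉S b∈S) })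
                        (λ { refl → inj₁ refl , a∈S })

ℬ-intro : ∀ {S} → cb ∈C S → ¬ ca ∈C S → ℬ S
ℬ-intro b∈S a∉S c = mk⇔ (λ { (inj₂ e , _) → e ; (inj₁ refl , a∈S) → ⊥-elim (a∉S a∈S) })
                        (λ { refl → inj₂ refl , b∈S })

𝒱-intro : ∀ {S} → cv ∈C S → ¬ cw ∈C S → 𝒱 S
𝒱-intro v∈S w∉S c = mk⇔ (λ { (inj₁ e , _) → e ; (inj₂ refl , w∈S) → ⊥-elim (w∉S w∈S) })
                        (λ { refl → inj₁ refl , v∈S })

𝒲-intro : ∀ {S} → cw ∈C S → ¬ cv ∈C S → 𝒲 S
𝒲-intro w∈S v∉S c = mk⇔ (λ { (inj₂ e , _) → e ; (inj₁ refl , v∈S) → ⊥-elim (v∉S v∈S) })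
                        (λ { refl → inj₂ refl , w∈S })

𝒜⇒cb∉ : ∀ {S} → 𝒜 S → ¬ cb ∈C S
𝒜⇒cb∉ A b∈S = case to (A cb) (inj₂ refl , b∈S) of λ ()

ℬ⇒ca∉ : ∀ {S} → ℬ S → ¬ ca ∈C S
ℬ⇒ca∉ B a∈S = case to (B ca) (inj₁ refl , a∈S) of λ ()

𝒱⇒cw∉ : ∀ {S} → 𝒱 S → ¬ cw ∈C S
𝒱⇒cw∉ V w∈S = case to (V cw) (inj₂ refl , w∈S) of λ ()

𝒲⇒cv∉ : ∀ {S} → 𝒲 S → ¬ cv ∈C S
𝒲⇒cv∉ W v∈S = case to (W cv) (inj₁ refl , v∈S) of λ ()

𝒜? : ∀ S → Dec (𝒜 S)
𝒜? `av = yes (𝒜-intro a∈av λ ())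
𝒜? `aw = yes (𝒜-intro a∈aw λ ())
𝒜? `bv = no (λ A → 𝒜⇒cb∉ A b∈bv)
𝒜? `bw = no (λ A → 𝒜⇒cb∉ A b∈bw)
𝒜? `abv = no (λ A → 𝒜⇒cb∉ A b∈abv)
𝒜? `abw = no (λ A → 𝒜⇒cb∉ A b∈abw)
𝒜? `avw = yes (𝒜-intro a∈avw λ ())
𝒜? `bvw = no (λ A → 𝒜⇒cb∉ A b∈bvw)

𝒱? : ∀ S → Dec (𝒱 S)
𝒱? `av = yes (𝒱-intro v∈av λ ())
𝒱? `aw = no (λ V → 𝒱⇒cw∉ V w∈aw)
𝒱? `bv = yes (𝒱-intro v∈bv λ ())
𝒱? `bw = no (λ V → 𝒱⇒cw∉ V w∈bw)
𝒱? `abv = yes (𝒱-intro v∈abv λ ())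
𝒱? `abw = no (λ V → 𝒱⇒cw∉ V w∈abw)
𝒱? `avw = no (λ V → 𝒱⇒cw∉ V w∈avw)
𝒱? `bvw = no (λ V → 𝒱⇒cw∉ V w∈bvw)

𝒜ℬ𝒱𝒲-cover : ∀ S → 𝒜 S ⊎ ℬ S ⊎ 𝒱 S ⊎ 𝒲 S
𝒜ℬ𝒱𝒲-cover `av = inj₁ (𝒜-intro a∈av λ ())
𝒜ℬ𝒱𝒲-cover `aw = inj₁ (𝒜-intro a∈aw λ ())
𝒜ℬ𝒱𝒲-cover `bv = inj₂ (inj₁ (ℬ-intro b∈bv λ ()))
𝒜ℬ𝒱𝒲-cover `bw = inj₂ (inj₁ (ℬ-intro b∈bw λ ()))
𝒜ℬ𝒱𝒲-cover `abv = inj₂ (inj₂ (inj₁ (𝒱-intro v∈abv λ ())))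
𝒜ℬ𝒱𝒲-cover `abw = inj₂ (inj₂ (inj₂ (𝒲-intro w∈abw λ ())))
𝒜ℬ𝒱𝒲-cover `avw = inj₁ (𝒜-intro a∈avw λ ())
𝒜ℬ𝒱𝒲-cover `bvw = inj₂ (inj₁ (ℬ-intro b∈bvw λ ()))

ℬ-𝒜-¬LEdge : ∀ {S T} → ℬ S → 𝒜 T → ¬ LEdgeC S T
ℬ-𝒜-¬LEdge B A (c , c∈L , c∈S , c∈T) with to (B c) (c∈L , c∈S) | to (A c) (c∈L , c∈T)
... | refl | ()

𝒲-𝒱-¬UEdge : ∀ {S T} → 𝒲 S → 𝒱 T → ¬ UEdgeC S T
𝒲-𝒱-¬UEdge W V (c , c∈U , c∈S , c∈T) with to (W c) (c∈U , c∈S) | to (V c) (c∈U , c∈T)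
... | refl | ()

omit : CPt → C23
omit ca = `bvw
omit cb = `avw
omit cv = `abw
omit cw = `abv

∈-omit : ∀ {c d} → d ≢ c → d ∈C omit c
∈-omit {ca} {ca} d≢c = ⊥-elim (d≢c refl)
∈-omit {ca} {cb} _ = b∈bvw
∈-omit {ca} {cv} _ = v∈bvw
∈-omit {ca} {cw} _ = w∈bvw
∈-omit {cb} {ca} _ = a∈avw
∈-omit {cb} {cb} d≢c = ⊥-elim (d≢c refl)
∈-omit {cb} {cv} _ = v∈avw
∈-omit {cb} {cw} _ = w∈avw
∈-omit {cv} {ca} _ = a∈abw
∈-omit {cv} {cb} _ = b∈abw
∈-omit {cv} {cv} d≢c = ⊥-elim (d≢c refl)
∈-omit {cv} {cw} _ = w∈abw
∈-omit {cw} {ca} _ = a∈abv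
∈-omit {cw} {cb} _ = b∈abv
∈-omit {cw} {cv} _ = v∈abv
∈-omit {cw} {cw} d≢c = ⊥-elim (d≢c refl)

module _ {Q : CPt → Set} where

  first-missing : Dec (Q ca) → Dec (Q cb) → Dec (Q cv) → CPt
  first-missing (no _) _ _ = ca
  first-missing (yes _) (no _) _ = cb
  first-missing (yes _) (yes _) (no _) = cv
  first-missing (yes _) (yes _) (yes _) = cw

  first-missing-¬ : (qa : Dec (Q ca)) (qb : Dec (Q cb)) (qv : Dec (Q cv)) →
    ¬ (∀ c → Q c) → ¬ Q (first-missing qa qb qv)
  first-missing-¬ (no ¬a) _ _ _ = ¬a
  first-missing-¬ (yes _) (no ¬b) _ _ = ¬b
  first-missing-¬ (yes _) (yes _) (no ¬v) _ = ¬v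
  first-missing-¬ (yes a) (yes b) (yes v) ¬all w =
    ¬all λ { ca → a ; cb → b ; cv → v ; cw → w }

dual : FinPoset → FinPoset
dual P = record
  { n = n ; _≤_ = flip _≤_ ; isPartialOrder = Flip.isPartialOrder isPartialOrder ; _≤?_ = flip _≤?_ }
  where open FinPoset P

module _ (P : FinPoset) where
  open FinPoset P
  open IsPartialOrder isPartialOrder using () renaming (refl to ≤-refl; trans to ≤-trans)

  Minimal? : ∀ x → Dec (Minimal P x)
  Minimal? x = all? (λ y → (y ≤? x) →-dec (y ≟ x))

  minimal-below : ∀ z → ∃[ m ] (Minimal P m × m ≤ z)
  minimal-below z = go (po-wellFounded isPartialOrder z)
    where
    go : ∀ {z} → Acc (_<_ P) z → ∃[ m ] (Minimal P m × m ≤ z)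
    go {z} (acc below) with any? (λ y → (y ≤? z) ×-dec ¬? (y ≟ z))
    ... | yes (y , y<z) = let m , mm , m≤y = go (below y<z) in m , mm , ≤-trans m≤y (proj₁ y<z)
    ... | no ∄y<z = z , (λ y y≤z → decidable-stable (y ≟ z) (λ y≢z → ∄y<z (y , y≤z , y≢z))) , ≤-refl

module _ (P : FinPoset) where
  open FinPoset P
  open IsPartialOrder isPartialOrder using (antisym; reflexive) renaming (refl to ≤-refl; trans to ≤-trans)

  Maximal? : ∀ x → Dec (Maximal P x)
  Maximal? = Minimal? (dual P)

  maximal-above : ∀ z → ∃[ m ] (Maximal P m × z ≤ m)
  maximal-above = minimal-below (dual P)

  <⇒¬minimal : ∀ {x y} → _<_ P x y → ¬ Minimal P y
  <⇒¬minimal (x≤y , x≢y) my = x≢y (my _ x≤y)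

  <⇒¬maximal : ∀ {x y} → _<_ P x y → ¬ Maximal P x
  <⇒¬maximal (x≤y , x≢y) mx = x≢y (sym (mx _ x≤y))

  extremal-below⇒minimal : ∀ {x y} → _<_ P x y → Extremal P x → Minimal P x
  extremal-below⇒minimal x<y = [ (λ mx → mx) , ⊥-elim ∘ <⇒¬maximal x<y ]′

  extremal-above⇒maximal : ∀ {x y} → _<_ P x y → Extremal P y → Maximal P y
  extremal-above⇒maximal x<y = [ ⊥-elim ∘ <⇒¬minimal x<y , (λ my → my) ]′

  minimals-incomparable : ∀ {x y} → Minimal P x → Minimal P y → x ≢ y → ¬ Comparable P x y
  minimals-incomparable mx my x≢y (inj₁ x≤y) = x≢y (my _ x≤y)
  minimals-incomparable mx my x≢y (inj₂ y≤x) = x≢y (sym (mx _ y≤x))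

  maximals-incomparable : ∀ {x y} → Maximal P x → Maximal P y → x ≢ y → ¬ Comparable P x y
  maximals-incomparable mx my x≢y (inj₁ x≤y) = x≢y (sym (mx _ x≤y))
  maximals-incomparable mx my x≢y (inj₂ y≤x) = x≢y (my _ y≤x)

  isolated : ∀ {x u} → Minimal P x → Maximal P x → CompPath P x u → u ≡ x
  isolated mn mx here = refl
  isolated mn mx (step (inj₁ x≤y) p) with mx _ x≤y
  ... | refl = isolated mn mx p
  isolated mn mx (step (inj₂ y≤x) p) with mn _ y≤x
  ... | refl = isolated mn mx p

  corners-mono : ∀ {a b v w c d} → a ≤ v → a ≤ w → b ≤ v → b ≤ w →
    c ≤C d → corners a b v w c ≤ corners a b v w d
  corners-mono _ _ _ _ ≤C-refl = ≤-refl
  corners-mono av _ _ _ a≤v = av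
  corners-mono _ aw _ _ a≤w = aw
  corners-mono _ _ bv _ b≤v = bv
  corners-mono _ _ _ bw b≤w = bw

  _<?_ : ∀ x y → Dec (_<_ P x y)
  x <? y = (x ≤? y) ×-dec ¬? (x ≟ y)

  Crown4? : ∀ a b v w → Dec (Crown4 P a b v w)
  Crown4? a b v w = a <? v ×-dec a <? w ×-dec b <? v ×-dec b <? w ×-dec
    ¬? ((a ≤? b) ⊎-dec (b ≤? a)) ×-dec ¬? ((v ≤? w) ⊎-dec (w ≤? v))

  InF? : ∀ F → Dec (InF P F)
  InF? F = improper? ×-dec all? (λ z → (z ∈? F) →-dec (Minimal? P z ⊎-dec Maximal? z))
    where
    improper? : Dec (ImproperCrown4 P F)
    improper? = any? λ a → any? λ b → any? λ v → any? λ w → Crown4? a b v w ×-dec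
      all? (λ z → (z ∈? F) ⇔-dec ((z ≟ a) ⊎-dec (z ≟ b) ⊎-dec (z ≟ v) ⊎-dec (z ≟ w))) ×-dec
      any? (λ z → ((a ≤? z) ×-dec (z ≤? v)) ×-dec ((b ≤? z) ×-dec (z ≤? w)))

  inner-bounds : ∀ {F} → ImproperCrown4 P F →
    ∃[ z ] ((∀ {m} → m ∈ F → Minimal P m → m ≤ z) × (∀ {t} → t ∈ F → Maximal P t → z ≤ t))
  inner-bounds {F} (a , b , v , w , (a<v , a<w , b<v , b<w , _) , F≡ , z , (a≤z , z≤v) , (b≤z , z≤w)) =
    z , below , above
    where
    below : ∀ {m} → m ∈ F → Minimal P m → m ≤ z
    below m∈F mm with to (F≡ _) m∈F
    ... | inj₁ refl = a≤z
    ... | inj₂ (inj₁ refl) = b≤z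
    ... | inj₂ (inj₂ (inj₁ refl)) = ⊥-elim (<⇒¬minimal a<v mm)
    ... | inj₂ (inj₂ (inj₂ refl)) = ⊥-elim (<⇒¬minimal a<w mm)
    above : ∀ {t} → t ∈ F → Maximal P t → z ≤ t
    above t∈F mt with to (F≡ _) t∈F
    ... | inj₁ refl = ⊥-elim (<⇒¬maximal a<v mt)
    ... | inj₂ (inj₁ refl) = ⊥-elim (<⇒¬maximal b<v mt)
    ... | inj₂ (inj₂ (inj₁ refl)) = z≤v
    ... | inj₂ (inj₂ (inj₂ refl)) = z≤w

  set4 : Fin n → Fin n → Fin n → Fin n → Subset n
  set4 a b v w = ⁅ a ⁆ ∪ (⁅ b ⁆ ∪ (⁅ v ⁆ ∪ ⁅ w ⁆))

  set4-spec : ∀ a b v w → IsSet4 P (set4 a b v w) a b v w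
  set4-spec a b v w z =
    (x∈⁅y⁆⇔x≡y ⊎-⇔ (x∈⁅y⁆⇔x≡y ⊎-⇔ (x∈⁅y⁆⇔x≡y ⊎-⇔ x∈⁅y⁆⇔x≡y) ⇔-∘ ∪⇔⊎) ⇔-∘ ∪⇔⊎) ⇔-∘ ∪⇔⊎

  improper-crown-of-extremals : ∀ {m₀ m₁ t₀ t₁ z} →
    Minimal P m₀ → Minimal P m₁ → m₀ ≢ m₁ → Maximal P t₀ → Maximal P t₁ → t₀ ≢ t₁ →
    m₀ ≤ z → m₁ ≤ z → z ≤ t₀ → z ≤ t₁ → InF P (set4 m₀ m₁ t₀ t₁)
  improper-crown-of-extremals {m₀} {m₁} {t₀} {t₁} {z} mm₀ mm₁ m₀≢m₁ mt₀ mt₁ t₀≢t₁ m₀≤z m₁≤z z≤t₀ z≤t₁ =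
    (m₀ , m₁ , t₀ , t₁ , crown , set4-spec m₀ m₁ t₀ t₁ , z , (m₀≤z , z≤t₀) , (m₁≤z , z≤t₁)) , extremal
    where
    below-both : ∀ {q} → q ≤ z → _<_ P q t₀ × _<_ P q t₁
    below-both q≤z =
      (≤-trans q≤z z≤t₀ , λ { refl → t₀≢t₁ (sym (mt₀ _ (≤-trans q≤z z≤t₁))) }) ,
      (≤-trans q≤z z≤t₁ , λ { refl → t₀≢t₁ (mt₁ _ (≤-trans q≤z z≤t₀)) })
    crown : Crown4 P m₀ m₁ t₀ t₁
    crown = proj₁ (below-both m₀≤z) , proj₂ (below-both m₀≤z) ,
            proj₁ (below-both m₁≤z) , proj₂ (below-both m₁≤z) ,
            minimals-incomparable mm₀ mm₁ m₀≢m₁ , maximals-incomparable mt₀ mt₁ t₀≢t₁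
    extremal : ∀ u → u ∈ set4 m₀ m₁ t₀ t₁ → Extremal P u
    extremal u u∈F with to (set4-spec m₀ m₁ t₀ t₁ u) u∈F
    ... | inj₁ refl = inj₁ mm₀
    ... | inj₂ (inj₁ refl) = inj₁ mm₁
    ... | inj₂ (inj₂ (inj₁ refl)) = inj₂ mt₀
    ... | inj₂ (inj₂ (inj₂ refl)) = inj₂ mt₁

  -- Separating homomorphisms from homomorphisms onto C

  module HomToSeparating (f : Fin n → CPt) (mono : ∀ x y → x ≤ y → f x ≤C f y) where

    Hit : Subset n → CPt → Set
    Hit F ca = ∃[ m ] (m ∈ F × Minimal P m × f m ≢ cb)
    Hit F cb = ∃[ m ] (m ∈ F × Minimal P m × f m ≡ cb)
    Hit F cv = ∃[ t ] (t ∈ F × Maximal P t × f t ≢ cw)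
    Hit F cw = ∃[ t ] (t ∈ F × Maximal P t × f t ≡ cw)

    Hit? : ∀ F c → Dec (Hit F c)
    Hit? F ca = any? λ m → (m ∈? F) ×-dec Minimal? P m ×-dec ¬? (≡cb? (f m))
    Hit? F cb = any? λ m → (m ∈? F) ×-dec Minimal? P m ×-dec ≡cb? (f m)
    Hit? F cv = any? λ t → (t ∈? F) ×-dec Maximal? t ×-dec ¬? (≡cw? (f t))
    Hit? F cw = any? λ t → (t ∈? F) ×-dec Maximal? t ×-dec ≡cw? (f t)

    -- f maps the inner of F to a single point of C, which rules out all four classes.
    not-all-hit : ∀ {F} → InF P F → ¬ (∀ c → Hit F c)
    not-all-hit (improper , _) hit
      with inner-bounds improper | hit ca | hit cb | hit cv | hit cw
    ... | z , below , above | m₀ , m₀∈F , mm₀ , e₀ | m₁ , m₁∈F , mm₁ , e₁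
        | t₀ , t₀∈F , mt₀ , e₂ | t₁ , t₁∈F , mt₁ , e₃ =
      no-point-between-mixed-bounds
        (mono _ _ (below m₀∈F mm₀)) (mono _ _ (below m₁∈F mm₁))
        (mono _ _ (above t₀∈F mt₀)) (mono _ _ (above t₁∈F mt₁)) e₀ e₁ e₂ e₃

    missing : Subset n → CPt
    missing F = first-missing {Q = Hit F} (Hit? F ca) (Hit? F cb) (Hit? F cv)

    missing-not-hit : ∀ {F} → InF P F → ¬ Hit F (missing F)
    missing-not-hit {F} iF = first-missing-¬ (Hit? F ca) (Hit? F cb) (Hit? F cv) (not-all-hit iF)

    φ : Subset n → C23
    φ F = omit (missing F)

    hit⇒∈φ : ∀ {F c} → InF P F → Hit F c → c ∈C φ F
    hit⇒∈φ iF h = ∈-omit λ e → missing-not-hit iF (subst (Hit _) e h)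

    φ-hom : IsHom P φ
    φ-hom F G iF iG = L-edge , U-edge
      where
      L-edge : LEdgeP P F G → LEdgeC (φ F) (φ G)
      L-edge (m , mm , m∈F , m∈G) with ≡cb? (f m)
      ... | yes e = cb , inj₂ refl , hit⇒∈φ iF (m , m∈F , mm , e) , hit⇒∈φ iG (m , m∈G , mm , e)
      ... | no e = ca , inj₁ refl , hit⇒∈φ iF (m , m∈F , mm , e) , hit⇒∈φ iG (m , m∈G , mm , e)
      U-edge : UEdgeP P F G → UEdgeC (φ F) (φ G)
      U-edge (t , mt , t∈F , t∈G) with ≡cw? (f t)
      ... | yes e = cw , inj₂ refl , hit⇒∈φ iF (t , t∈F , mt , e) , hit⇒∈φ iG (t , t∈G , mt , e)
      ... | no e = cv , inj₁ refl , hit⇒∈φ iF (t , t∈F , mt , e) , hit⇒∈φ iG (t , t∈G , mt , e)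

    φ-separating : ∀ {x x′ y y′} → Minimal P x → Minimal P x′ → Maximal P y → Maximal P y′ →
      (∀ c → f (corners x′ x y′ y c) ≡ c) → SeparatingWith P φ x x′ y y′
    φ-separating {x} {x′} {y} {y′} mx mx′ my my′ sec =
      mx , mx′ , distinct {cb} {ca} (λ ()) , my , my′ , distinct {cw} {cv} (λ ()) , λ F iF →
        (λ x∈F A → 𝒜⇒cb∉ A (hit⇒∈φ iF (x , x∈F , mx , sec cb))) ,
        (λ x′∈F B → ℬ⇒ca∉ B (hit⇒∈φ iF (x′ , x′∈F , mx′ , ca≢cb ∘ trans (sym (sec ca))))) ,
        (λ y∈F V → 𝒱⇒cw∉ V (hit⇒∈φ iF (y , y∈F , my , sec cw))) ,
        (λ y′∈F W → 𝒲⇒cv∉ W (hit⇒∈φ iF (y′ , y′∈F , my′ , cv≢cw ∘ trans (sym (sec cv)))))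
      where
      distinct : ∀ {c d} → c ≢ d → corners x′ x y′ y c ≢ corners x′ x y′ y d
      distinct c≢d = c≢d ∘ section⇒injective {f = f} {h = corners x′ x y′ y} sec

  -- Homomorphisms onto C from separating homomorphisms

  module SeparatingToHom (conn : Connected P) (φ : Subset n → C23) (hom : IsHom P φ)
    {x x′ y y′ : Fin n} (mx : Minimal P x) (mx′ : Minimal P x′) (x≢x′ : x ≢ x′)
    (my : Maximal P y) (my′ : Maximal P y′) (y≢y′ : y ≢ y′)
    (avoid : ∀ F → InF P F →
      (x ∈ F → ¬ 𝒜 (φ F)) × (x′ ∈ F → ¬ ℬ (φ F)) × (y ∈ F → ¬ 𝒱 (φ F)) × (y′ ∈ F → ¬ 𝒲 (φ F)))
    where

    -- A minimal point satisfying InA is to be sent to a, any other one to b;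
    -- dually a maximal point goes to v or w according to InV.
    InA : Fin n → Set
    InA m = (∃[ F ] (InF P F × m ∈ F × 𝒜 (φ F))) ⊎ (m ≡ x′)

    InV : Fin n → Set
    InV t = (∃[ F ] (InF P F × t ∈ F × 𝒱 (φ F))) ⊎ (t ≡ y′)

    InA? : ∀ m → Dec (InA m)
    InA? m = anySubset? (λ F → InF? F ×-dec (m ∈? F) ×-dec 𝒜? (φ F)) ⊎-dec (m ≟ x′)

    InV? : ∀ t → Dec (InV t)
    InV? t = anySubset? (λ F → InF? F ×-dec (t ∈? F) ×-dec 𝒱? (φ F)) ⊎-dec (t ≟ y′)

    ℬ⇒¬InA : ∀ {F m} → InF P F → m ∈ F → Minimal P m → ℬ (φ F) → ¬ InA m
    ℬ⇒¬InA iF m∈F mm B (inj₁ (G , iG , m∈G , A)) =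
      ℬ-𝒜-¬LEdge B A (proj₁ (hom _ G iF iG) (_ , mm , m∈F , m∈G))
    ℬ⇒¬InA iF m∈F mm B (inj₂ refl) = proj₁ (proj₂ (avoid _ iF)) m∈F B

    𝒲⇒¬InV : ∀ {F t} → InF P F → t ∈ F → Maximal P t → 𝒲 (φ F) → ¬ InV t
    𝒲⇒¬InV iF t∈F mt W (inj₁ (G , iG , t∈G , V)) =
      𝒲-𝒱-¬UEdge W V (proj₂ (hom _ G iF iG) (_ , mt , t∈F , t∈G))
    𝒲⇒¬InV iF t∈F mt W (inj₂ refl) = proj₂ (proj₂ (proj₂ (avoid _ iF))) t∈F W

    -- The four points form a crown in 𝓕(P), and whichever of 𝒜, ℬ, 𝒱, 𝒲 contains its image
    -- contradicts one of the four labels.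
    no-split-crown : ∀ {m₀ m₁ t₀ t₁ z} → Minimal P m₀ → Minimal P m₁ → Maximal P t₀ → Maximal P t₁ →
      m₀ ≤ z → m₁ ≤ z → z ≤ t₀ → z ≤ t₁ → InA m₀ → ¬ InA m₁ → InV t₀ → ¬ InV t₁ → ⊥
    no-split-crown {m₀} {m₁} {t₀} {t₁} mm₀ mm₁ mt₀ mt₁ m₀≤z m₁≤z z≤t₀ z≤t₁ a₀ ¬a₁ v₀ ¬v₁ =
      case 𝒜ℬ𝒱𝒲-cover (φ (set4 m₀ m₁ t₀ t₁)) of λ
        { (inj₁ A) → ¬a₁ (inj₁ (_ , crown∈𝓕 , ∈F (inj₂ (inj₁ refl)) , A))
        ; (inj₂ (inj₁ B)) → ℬ⇒¬InA crown∈𝓕 (∈F (inj₁ refl)) mm₀ B a₀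
        ; (inj₂ (inj₂ (inj₁ V))) → ¬v₁ (inj₁ (_ , crown∈𝓕 , ∈F (inj₂ (inj₂ (inj₂ refl))) , V))
        ; (inj₂ (inj₂ (inj₂ W))) → 𝒲⇒¬InV crown∈𝓕 (∈F (inj₂ (inj₂ (inj₁ refl)))) mt₀ W v₀
        }
      where
      ∈F : ∀ {u} → OneOf m₀ m₁ t₀ t₁ u → u ∈ set4 m₀ m₁ t₀ t₁
      ∈F = from (set4-spec m₀ m₁ t₀ t₁ _)
      crown∈𝓕 : InF P (set4 m₀ m₁ t₀ t₁)
      crown∈𝓕 = improper-crown-of-extremals mm₀ mm₁ (λ { refl → ¬a₁ a₀ }) mt₀ mt₁ (λ { refl → ¬v₁ v₀ })
        m₀≤z m₁≤z z≤t₀ z≤t₁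

    SplitAbove : Fin n → Set
    SplitAbove z = ∃[ t₀ ] ∃[ t₁ ] ((Maximal P t₀ × z ≤ t₀ × InV t₀) × (Maximal P t₁ × z ≤ t₁ × ¬ InV t₁))

    Low : Fin n → Set
    Low z = Minimal P z ⊎ SplitAbove z

    BelowB : Fin n → Set
    BelowB z = ∃[ m ] (Minimal P m × m ≤ z × ¬ InA m)

    AboveW : Fin n → Set
    AboveW z = ∃[ t ] (Maximal P t × z ≤ t × ¬ InV t)

    Low? : ∀ z → Dec (Low z)
    Low? z = Minimal? P z ⊎-dec any? λ t₀ → any? λ t₁ →
      (Maximal? t₀ ×-dec (z ≤? t₀) ×-dec InV? t₀) ×-dec (Maximal? t₁ ×-dec (z ≤? t₁) ×-dec ¬? (InV? t₁))

    BelowB? : ∀ z → Dec (BelowB z)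
    BelowB? z = any? λ m → Minimal? P m ×-dec (m ≤? z) ×-dec ¬? (InA? m)

    AboveW? : ∀ z → Dec (AboveW z)
    AboveW? z = any? λ t → Maximal? t ×-dec (z ≤? t) ×-dec ¬? (InV? t)

    -- A point below maximal points labelled v and w can only go to a or b.
    f : Fin n → CPt
    f z = if does (Low? z)
          then (if does (BelowB? z) then cb else ca)
          else (if does (AboveW? z) then cw else cv)

    f-low : ∀ {z} → Low z → f z ≡ (if does (BelowB? z) then cb else ca)
    f-low {z} low rewrite dec-true (Low? z) low = refl

    f-high : ∀ {z} → ¬ Low z → f z ≡ (if does (AboveW? z) then cw else cv)
    f-high {z} ¬low rewrite dec-false (Low? z) ¬low = refl

    Low-down : ∀ {u z} → u ≤ z → Low z → Low u
    Low-down u≤z (inj₁ mz) = inj₁ (subst (Minimal P) (sym (mz _ u≤z)) mz)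
    Low-down u≤z (inj₂ (t₀ , t₁ , (mt₀ , z≤t₀ , v₀) , (mt₁ , z≤t₁ , ¬v₁))) =
      inj₂ (t₀ , t₁ , (mt₀ , ≤-trans u≤z z≤t₀ , v₀) , (mt₁ , ≤-trans u≤z z≤t₁ , ¬v₁))

    BelowB-low⇔ : ∀ {u z} → u ≤ z → Low z → BelowB u ⇔ BelowB z
    BelowB-low⇔ {u} {z} u≤z low-z = mk⇔
      (λ (m , mm , m≤u , ¬a) → m , mm , ≤-trans m≤u u≤z , ¬a)
      (λ (m₁ , mm₁ , m₁≤z , ¬a₁) → let m₀ , mm₀ , m₀≤u = minimal-below P u in
        m₀ , mm₀ , m₀≤u , λ a₀ → labels-clash mm₀ (≤-trans m₀≤u u≤z) a₀ mm₁ m₁≤z ¬a₁ low-z)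
      where
      labels-clash : ∀ {m₀ m₁} → Minimal P m₀ → m₀ ≤ z → InA m₀ → Minimal P m₁ → m₁ ≤ z → ¬ InA m₁ →
        Low z → ⊥
      labels-clash _ m₀≤z a₀ _ m₁≤z ¬a₁ (inj₁ mz) = ¬a₁ (subst InA (trans (mz _ m₀≤z) (sym (mz _ m₁≤z))) a₀)
      labels-clash mm₀ m₀≤z a₀ mm₁ m₁≤z ¬a₁ (inj₂ (_ , _ , (mt₀ , z≤t₀ , v₀) , (mt₁ , z≤t₁ , ¬v₁))) =
        no-split-crown mm₀ mm₁ mt₀ mt₁ m₀≤z m₁≤z z≤t₀ z≤t₁ a₀ ¬a₁ v₀ ¬v₁

    AboveW-high⇔ : ∀ {u z} → u ≤ z → ¬ Low u → AboveW u ⇔ AboveW z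
    AboveW-high⇔ {u} {z} u≤z ¬low-u = mk⇔
      (λ (t₁ , mt₁ , u≤t₁ , ¬v₁) → let t₀ , mt₀ , z≤t₀ = maximal-above z in
        t₀ , mt₀ , z≤t₀ , λ v₀ →
          ¬low-u (inj₂ (t₀ , t₁ , (mt₀ , ≤-trans u≤z z≤t₀ , v₀) , (mt₁ , u≤t₁ , ¬v₁))))
      (λ (t , mt , z≤t , ¬v) → t , mt , ≤-trans u≤z z≤t , ¬v)

    low≤high : ∀ p q → (if p then cb else ca) ≤C (if q then cw else cv)
    low≤high true true = b≤w
    low≤high true false = b≤v
    low≤high false true = a≤w
    low≤high false false = a≤v

    f-mono : ∀ u z → u ≤ z → f u ≤C f z
    f-mono u z u≤z with Low? z | Low? u
    ... | yes low-z | _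
      rewrite f-low (Low-down u≤z low-z) | f-low low-z
            | does-⇔ (BelowB-low⇔ u≤z low-z) (BelowB? u) (BelowB? z) = ≤C-refl
    ... | no ¬low-z | yes low-u rewrite f-low low-u | f-high ¬low-z = low≤high _ _
    ... | no ¬low-z | no ¬low-u
      rewrite f-high ¬low-u | f-high ¬low-z
            | does-⇔ (AboveW-high⇔ u≤z ¬low-u) (AboveW? u) (AboveW? z) = ≤C-refl

    maximal⇒¬Low : ∀ {t} → Maximal P t → ¬ Minimal P t → ¬ Low t
    maximal⇒¬Low mt ¬mt (inj₁ mn) = ¬mt mn
    maximal⇒¬Low mt _ (inj₂ (_ , _ , (_ , t≤t₀ , v₀) , (_ , t≤t₁ , ¬v₁))) =
      ¬v₁ (subst InV (trans (mt _ t≤t₀) (sym (mt _ t≤t₁))) v₀)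

    ¬InA-x : ¬ InA x
    ¬InA-x (inj₁ (F , iF , x∈F , A)) = proj₁ (avoid F iF) x∈F A
    ¬InA-x (inj₂ x≡x′) = x≢x′ x≡x′

    ¬InV-y : ¬ InV y
    ¬InV-y (inj₁ (F , iF , y∈F , V)) = proj₁ (proj₂ (proj₂ (avoid F iF))) y∈F V
    ¬InV-y (inj₂ y≡y′) = y≢y′ y≡y′

    ¬BelowB-x′ : ¬ BelowB x′
    ¬BelowB-x′ (m , _ , m≤x′ , ¬a) = ¬a (inj₂ (mx′ m m≤x′))

    ¬AboveW-y′ : ¬ AboveW y′
    ¬AboveW-y′ (t , _ , y′≤t , ¬v) = ¬v (inj₂ (my′ t y′≤t))

    ¬Low-y : ¬ Low y
    ¬Low-y = maximal⇒¬Low my λ my-min → y≢y′ (sym (isolated my-min my (conn y y′)))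

    ¬Low-y′ : ¬ Low y′
    ¬Low-y′ = maximal⇒¬Low my′ λ my′-min → y≢y′ (isolated my′-min my′ (conn y′ y))

    f-corners : ∀ c → f (corners x′ x y′ y c) ≡ c
    f-corners ca rewrite f-low (inj₁ mx′) | dec-false (BelowB? x′) ¬BelowB-x′ = refl
    f-corners cb rewrite f-low (inj₁ mx) | dec-true (BelowB? x) (x , mx , ≤-refl , ¬InA-x) = refl
    f-corners cv rewrite f-high ¬Low-y′ | dec-false (AboveW? y′) ¬AboveW-y′ = refl
    f-corners cw rewrite f-high ¬Low-y | dec-true (AboveW? y) (y , my , ≤-refl , ¬InV-y) = refl

  minimal-preimage : (f : Fin n → CPt) → (∀ x y → x ≤ y → f x ≤C f y) →
    ∀ {c} → LC c → ∃[ u ] (f u ≡ c) → ∃[ m ] (Minimal P m × f m ≡ c)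
  minimal-preimage f mono c∈L (u , fu≡c) = let m , mm , m≤u = minimal-below P u in
    m , mm , ≤C-minimal c∈L (subst (f m ≤C_) fu≡c (mono m u m≤u))

  maximal-preimage : (f : Fin n → CPt) → (∀ x y → x ≤ y → f x ≤C f y) →
    ∀ {c} → UC c → ∃[ u ] (f u ≡ c) → ∃[ t ] (Maximal P t × f t ≡ c)
  maximal-preimage f mono c∈U (u , fu≡c) = let t , mt , u≤t = maximal-above u in
    t , mt , ≤C-maximal c∈U (subst (_≤C f t) fu≡c (mono u t u≤t))

  surjective⇔separating : Connected P →
    SurjHomOntoC P ⇔ (Σ (Subset n → C23) λ φ → (IsHom P φ × Separating P φ))
  surjective⇔separating conn = mk⇔ hom⇒separating separating⇒hom
    where
    hom⇒separating : SurjHomOntoC P → Σ (Subset n → C23) λ φ → (IsHom P φ × Separating P φ)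
    hom⇒separating (f , mono , onto)
      with minimal-preimage f mono (inj₂ refl) (onto cb) | minimal-preimage f mono (inj₁ refl) (onto ca)
         | maximal-preimage f mono (inj₂ refl) (onto cw) | maximal-preimage f mono (inj₁ refl) (onto cv)
    ... | x , mx , fx | x′ , mx′ , fx′ | y , my , fy | y′ , my′ , fy′ =
      φ , φ-hom , x , x′ , y , y′ , φ-separating mx mx′ my my′ λ { ca → fx′ ; cb → fx ; cv → fy′ ; cw → fy }
      where open HomToSeparating f mono
    separating⇒hom : (Σ (Subset n → C23) λ φ → (IsHom P φ × Separating P φ)) → SurjHomOntoC P
    separating⇒hom (φ , hom , x , x′ , y , y′ , mx , mx′ , x≢x′ , my , my′ , y≢y′ , avoid) =
      f , f-mono , λ c → corners x′ x y′ y c , f-corners c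
      where open SeparatingToHom conn φ hom mx mx′ x≢x′ my my′ y≢y′ avoid

  -- Retracts onto a 4-crown of E(P)

  module Crown {a b v w : Fin n} (a<v : _<_ P a v) (a<w : _<_ P a w) (b<v : _<_ P b v) (b<w : _<_ P b w)
    (a≁b : ¬ Comparable P a b) (v≁w : ¬ Comparable P v w) where

    <⇒≱ : ∀ {p q} → _<_ P p q → ¬ q ≤ p
    <⇒≱ (p≤q , p≢q) q≤p = p≢q (antisym p≤q q≤p)

    corners-reflects : ∀ {c d} → corners a b v w c ≤ corners a b v w d → c ≤C d
    corners-reflects {ca} {ca} _ = ≤C-refl
    corners-reflects {ca} {cb} a≤b = ⊥-elim (a≁b (inj₁ a≤b))
    corners-reflects {ca} {cv} _ = a≤v
    corners-reflects {ca} {cw} _ = a≤w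
    corners-reflects {cb} {ca} b≤a = ⊥-elim (a≁b (inj₂ b≤a))
    corners-reflects {cb} {cb} _ = ≤C-refl
    corners-reflects {cb} {cv} _ = b≤v
    corners-reflects {cb} {cw} _ = b≤w
    corners-reflects {cv} {ca} v≤a = ⊥-elim (<⇒≱ a<v v≤a)
    corners-reflects {cv} {cb} v≤b = ⊥-elim (<⇒≱ b<v v≤b)
    corners-reflects {cv} {cv} _ = ≤C-refl
    corners-reflects {cv} {cw} v≤w = ⊥-elim (v≁w (inj₁ v≤w))
    corners-reflects {cw} {ca} w≤a = ⊥-elim (<⇒≱ a<w w≤a)
    corners-reflects {cw} {cb} w≤b = ⊥-elim (<⇒≱ b<w w≤b)
    corners-reflects {cw} {cv} w≤v = ⊥-elim (v≁w (inj₂ w≤v))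
    corners-reflects {cw} {cw} _ = ≤C-refl

    corners-injective : ∀ {c d} → corners a b v w c ≡ corners a b v w d → c ≡ d
    corners-injective e = ≤C-antisym (corners-reflects (reflexive e)) (corners-reflects (reflexive (sym e)))

    retract⇒section : IsRetract4 P a b v w →
      Σ (Fin n → CPt) λ f → (∀ x y → x ≤ y → f x ≤C f y) × (∀ c → f (corners a b v w c) ≡ c)
    retract⇒section (r , r-mono , r-idem , r-image) = f , f-mono , f-corners
      where
      label : ∀ z → ∃[ c ] (corners a b v w c ≡ r z)
      label z = corners-onto (to (r-image (r z)) (z , refl))
      f : Fin n → CPt
      f z = proj₁ (label z)
      f-mono : ∀ x y → x ≤ y → f x ≤C f y
      f-mono x y x≤y =
        corners-reflects (subst₂ _≤_ (sym (proj₂ (label x))) (sym (proj₂ (label y))) (r-mono x y x≤y))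
      f-corners : ∀ c → f (corners a b v w c) ≡ c
      f-corners c = corners-injective (trans (proj₂ (label (corners a b v w c)))
        (retraction-fixes-image r-idem (proj₂ (from (r-image (corners a b v w c)) (corners-∈ c)))))

    minimal∈L : ∀ {u} → Minimal P u → OneOf a b v w u → (u ≡ a) ⊎ (u ≡ b)
    minimal∈L _ (inj₁ e) = inj₁ e
    minimal∈L _ (inj₂ (inj₁ e)) = inj₂ e
    minimal∈L mu (inj₂ (inj₂ (inj₁ refl))) = ⊥-elim (<⇒¬minimal a<v mu)
    minimal∈L mu (inj₂ (inj₂ (inj₂ refl))) = ⊥-elim (<⇒¬minimal a<w mu)

    maximal∈U : ∀ {s} → Maximal P s → OneOf a b v w s → (s ≡ v) ⊎ (s ≡ w)
    maximal∈U ms (inj₁ refl) = ⊥-elim (<⇒¬maximal a<v ms)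
    maximal∈U ms (inj₂ (inj₁ refl)) = ⊥-elim (<⇒¬maximal b<v ms)
    maximal∈U _ (inj₂ (inj₂ (inj₁ e))) = inj₁ e
    maximal∈U _ (inj₂ (inj₂ (inj₂ e))) = inj₂ e

    minimal≤maximal : ∀ {u s} → Minimal P u → OneOf a b v w u → Maximal P s → OneOf a b v w s → u ≤ s
    minimal≤maximal mu u∈D ms s∈D with minimal∈L mu u∈D | maximal∈U ms s∈D
    ... | inj₁ refl | inj₁ refl = proj₁ a<v
    ... | inj₁ refl | inj₂ refl = proj₁ a<w
    ... | inj₂ refl | inj₁ refl = proj₁ b<v
    ... | inj₂ refl | inj₂ refl = proj₁ b<w

  retract⇔D-separating : Connected P → (a b v w : Fin n) → Crown4 P a b v w →
    Extremal P a → Extremal P b → Extremal P v → Extremal P w →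
    IsRetract4 P a b v w ⇔ (Σ (Subset n → C23) λ φ → (IsHom P φ × DSeparating P φ a b v w))
  retract⇔D-separating conn a b v w (a<v , a<w , b<v , b<w , a≁b , v≁w) ea eb ev ew =
    mk⇔ retract⇒separating separating⇒retract
    where
    open Crown a<v a<w b<v b<w a≁b v≁w

    -- f sends a, b, v, w to ca, cb, cv, cw, so the separating witnesses x, x′, y, y′ are b, a, w, v.
    retract⇒separating : IsRetract4 P a b v w →
      Σ (Subset n → C23) λ φ → (IsHom P φ × DSeparating P φ a b v w)
    retract⇒separating retract with retract⇒section retract
    ... | f , f-mono , f-corners =
      φ , φ-hom , b , a , w , v ,
      φ-separating (extremal-below⇒minimal b<v eb) (extremal-below⇒minimal a<v ea)
                   (extremal-above⇒maximal a<w ew) (extremal-above⇒maximal a<v ev) f-corners ,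
      λ _ → mk⇔ OneOf-swap OneOf-swap
      where open HomToSeparating f f-mono

    separating⇒retract : (Σ (Subset n → C23) λ φ → (IsHom P φ × DSeparating P φ a b v w)) →
      IsRetract4 P a b v w
    separating⇒retract
      (φ , hom , x , x′ , y , y′ , (mx , mx′ , x≢x′ , my , my′ , y≢y′ , avoid) , witnesses≡D) =
      h ∘ f , r-mono , (λ z → cong h (f-corners (f z))) , λ z → mk⇔ (image⊆D z) (D⊆image z)
      where
      open SeparatingToHom conn φ hom mx mx′ x≢x′ my my′ y≢y′ avoid
      h : CPt → Fin n
      h = corners x′ x y′ y
      h∈D : ∀ c → OneOf a b v w (h c)
      h∈D c = to (witnesses≡D _) (OneOf-swap (corners-∈ c))
      r-mono : ∀ p q → p ≤ q → h (f p) ≤ h (f q)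
      r-mono p q p≤q = corners-mono
        (minimal≤maximal mx′ (h∈D ca) my′ (h∈D cv)) (minimal≤maximal mx′ (h∈D ca) my (h∈D cw))
        (minimal≤maximal mx (h∈D cb) my′ (h∈D cv)) (minimal≤maximal mx (h∈D cb) my (h∈D cw))
        (f-mono p q p≤q)
      image⊆D : ∀ z → ∃[ u ] (h (f u) ≡ z) → OneOf a b v w z
      image⊆D z (u , e) = subst (OneOf a b v w) e (h∈D (f u))
      D⊆image : ∀ z → OneOf a b v w z → ∃[ u ] (h (f u) ≡ z)
      D⊆image z z∈D = let c , hc≡z = corners-onto (OneOf-swap (from (witnesses≡D z) z∈D)) in
        h c , trans (cong h (f-corners c)) hc≡z

theorem1 : (P : FinPoset) → Connected P → TwoMinimal P → TwoMaximal P →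
    (SurjHomOntoC P ⇔ (Σ (Subset (FinPoset.n P) → C23) λ φ → (IsHom P φ × Separating P φ))) ×
    ((a b v w : Fin (FinPoset.n P)) → Crown4 P a b v w →
      Extremal P a → Extremal P b → Extremal P v → Extremal P w →
      (IsRetract4 P a b v w ⇔ (Σ (Subset (FinPoset.n P) → C23) λ φ → (IsHom P φ × DSeparating P φ a b v w))))
theorem1 P conn _ _ = surjective⇔separating P conn , retract⇔D-separating P conn
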